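{- Let $G$ be a finite graph which is the edge-disjoint union of cycles $C_1,\dots,C_k$, each of length four, and a graph $E$, such that deleting from each $C_i$ two non-adjacent (opposite) edges yields a two-factor of $G$ (a spanning subgraph in which every vertex has degree exactly two). Then $G$ has a Hamiltonian cycle if and only if $G$ is connected.
   Context: "Halving" a $4$-cycle means deleting every second edge of it, i.e. deleting one of its two pairs of opposite edges; either choice leaves every vertex of the cycle with the same degree contribution, so the hypothesis does not depend on which pair is deleted. -}

module Defs where

open import Data.Nat using (ℕ; zero; suc; _∸_; _≤_)
open import Data.Fin using (Fin; toℕ; _≟_)
open import Data.Bool using (Bool; true; false; _∧_; _∨_; if_then_else_)
open import Data.List using (List; allFin; map)
open import Data.Nat.ListAction using (sum)
open import Data.Bool.ListAction using (any)
open import Data.Product using (Σ; _×_; ∃; ∃-syntax)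
open import Data.Sum using (_⊎_)
open import Function.Definitions using (Injective)
open import Relation.Binary.PropositionalEquality using (_≡_)
open import Relation.Nullary using (¬_)
open import Relation.Nullary.Decidable using (⌊_⌋)

record Graph (n : ℕ) : Set where
  field
    adj    : Fin n → Fin n → Bool
    sym    : ∀ u v → adj u v ≡ adj v u
    irrefl : ∀ u → adj u u ≡ false
open Graph public

eqᵇ : {n : ℕ} → Fin n → Fin n → Bool
eqᵇ u v = ⌊ u ≟ v ⌋

isEdge : {n : ℕ} → Fin n → Fin n → Fin n → Fin n → Bool
isEdge x y u v = (eqᵇ u x ∧ eqᵇ v y) ∨ (eqᵇ u y ∧ eqᵇ v x)

-- A 4-cycle a-b-c-d-a on four distinct vertices (edges ab, bc, cd, da).
record Square (n : ℕ) : Set where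
  field
    a b c d : Fin n
    a≢b : ¬ (a ≡ b)
    a≢c : ¬ (a ≡ c)
    a≢d : ¬ (a ≡ d)
    b≢c : ¬ (b ≡ c)
    b≢d : ¬ (b ≡ d)
    c≢d : ¬ (c ≡ d)
open Square public

sqEdge : {n : ℕ} → Square n → Fin n → Fin n → Bool
sqEdge q u v = isEdge (a q) (b q) u v ∨ isEdge (b q) (c q) u v
             ∨ isEdge (c q) (d q) u v ∨ isEdge (d q) (a q) u v

-- Halving the 4-cycle: delete the opposite pair ab, cd; keep bc, da.
-- (By the paper's remark, the choice of pair does not matter.)
halfEdge : {n : ℕ} → Square n → Fin n → Fin n → Bool
halfEdge q u v = isEdge (b q) (c q) u v ∨ isEdge (d q) (a q) u v

EdgeDisjointUnion : {n k : ℕ} → Graph n → (Fin k → Square n) → Graph n → Set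
EdgeDisjointUnion G sq E =
    (∀ u v → adj G u v ≡ true → adj E u v ≡ true ⊎ ∃[ i ] sqEdge (sq i) u v ≡ true)
  × (∀ u v → adj E u v ≡ true → adj G u v ≡ true)
  × (∀ i u v → sqEdge (sq i) u v ≡ true → adj G u v ≡ true)
  × (∀ i u v → sqEdge (sq i) u v ≡ true → adj E u v ≡ false)
  × (∀ i j u v → sqEdge (sq i) u v ≡ true → sqEdge (sq j) u v ≡ true → i ≡ j)

halvedAdj : {n k : ℕ} → (Fin k → Square n) → Graph n → Fin n → Fin n → Bool
halvedAdj {k = k} sq E u v = adj E u v ∨ any (λ i → halfEdge (sq i) u v) (allFin k)

degree : {n : ℕ} → (Fin n → Fin n → Bool) → Fin n → ℕ
degree {n} A u = sum (map (λ v → if A u v then 1 else 0) (allFin n))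

TwoFactor : {n : ℕ} → (Fin n → Fin n → Bool) → Set
TwoFactor A = ∀ u → degree A u ≡ 2

data Walk {n : ℕ} (G : Graph n) : Fin n → Fin n → Set where
  here : ∀ {u} → Walk G u u
  step : ∀ {u w v} → adj G u w ≡ true → Walk G w v → Walk G u v

Connected : {n : ℕ} → Graph n → Set
Connected {n} G = 1 ≤ n × (∀ u v → Walk G u v)

-- Hamiltonian cycle: a cyclic ordering σ(0),…,σ(n-1) of all vertices
-- (σ injective, hence bijective), n ≥ 3, with consecutive vertices adjacent
-- and σ(n-1) adjacent to σ(0).
Hamiltonian : {n : ℕ} → Graph n → Set
Hamiltonian {n} G = 3 ≤ n × Σ (Fin n → Fin n) λ σ → Injective _≡_ _≡_ σ ×
  (∀ i j → (toℕ j ≡ suc (toℕ i) ⊎ (toℕ i ≡ n ∸ 1 × toℕ j ≡ 0)) → adj G (σ i) (σ j) ≡ true)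

module Submission where

-- Hamiltonian ⇒ connected: walk along the Hamiltonian cycle.
-- Connected ⇒ Hamiltonian: F is 2-regular, so following F from any edge
-- closes up into an F-cycle containing every F-edge at its vertices.  Call a
-- cycle L of G saturated if every F-edge at a vertex of L is an edge of L or
-- a kept edge of a square with all four corners on L.  F-cycles are
-- saturated, and the vertex set of a saturated cycle is closed under F.  If a
-- saturated L misses a vertex, connectivity yields an edge of G leaving L;
-- it must be a deleted edge of a square, one of whose kept edges xx′ lies on
-- L while the other y′y lies on an F-cycle W disjoint from L.  Replacing xx′
-- and y′y by the deleted edges xy and y′x′ splices L and W into a longer
-- saturated cycle; after at most n steps the cycle is spanning.

open import Defs hiding (sym)
open import Data.Nat using (ℕ; zero; suc; NonZero; _+_; _*_; _∸_; _≤_; _<_; z≤n; s≤s; s≤s⁻¹; s<s⁻¹; _<?_; _≤?_; pred)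
open import Data.Nat.Properties
open import Data.Nat.DivMod
open import Data.Nat.Induction using (<-wellFounded)
open import Induction.WellFounded using (Acc; acc)
open import Data.Fin as Fin using (Fin; toℕ; fromℕ<) renaming (_≟_ to _≟F_)
import Data.Fin.Properties as FinP
open import Data.Bool using (Bool; true; false; _∧_; _∨_; if_then_else_)
open import Data.Bool.Properties using (T-≡)
open import Data.List using (allFin; map; tabulate)
open import Data.Nat.ListAction using (sum)
open import Data.List.Membership.Propositional using (lose)
open import Data.List.Membership.Propositional.Properties using (∈-allFin)
open import Data.List.Relation.Unary.Any using (satisfied)
open import Data.List.Relation.Unary.Any.Properties using (any⁺; any⁻)
open import Data.Bool.ListAction using (any)
open import Data.Product using (Σ; _×_; ∃; _,_; proj₁; proj₂)
open import Data.Sum using (_⊎_; inj₁; inj₂)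
open import Data.Empty using (⊥-elim)
open import Relation.Nullary using (¬_; Dec; yes; no; ¬?)
open import Relation.Nullary.Decidable using (decidable-stable)
open import Relation.Binary.PropositionalEquality
open import Relation.Binary.Definitions using (tri<; tri≈; tri>)
open import Function.Bundles using (_⇔_; mk⇔; Equivalence)
open import Function.Definitions using (Injective)

∨-elim : ∀ x y → x ∨ y ≡ true → x ≡ true ⊎ y ≡ true
∨-elim true  _ _ = inj₁ refl
∨-elim false _ e = inj₂ e

∨-introˡ : ∀ x y → x ≡ true → x ∨ y ≡ true
∨-introˡ true _ _ = refl

∨-introʳ : ∀ x y → y ≡ true → x ∨ y ≡ true
∨-introʳ true  _ _ = refl
∨-introʳ false _ e = e

∧-elim : ∀ x y → x ∧ y ≡ true → x ≡ true × y ≡ true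
∧-elim true true _ = refl , refl

eqᵇ-sound : ∀ {n} (u v : Fin n) → eqᵇ u v ≡ true → u ≡ v
eqᵇ-sound u v e with u ≟F v
... | yes u≡v = u≡v
eqᵇ-sound u v () | no _

eqᵇ-refl : ∀ {n} (u : Fin n) → eqᵇ u u ≡ true
eqᵇ-refl u with u ≟F u
... | yes _ = refl
... | no u≢u = ⊥-elim (u≢u refl)

isEdge-elim : ∀ {n} (x y u v : Fin n) → isEdge x y u v ≡ true → (u ≡ x × v ≡ y) ⊎ (u ≡ y × v ≡ x)
isEdge-elim x y u v e with ∨-elim _ _ e
... | inj₁ e₁ = let (p , q) = ∧-elim _ _ e₁ in inj₁ (eqᵇ-sound _ _ p , eqᵇ-sound _ _ q)
... | inj₂ e₂ = let (p , q) = ∧-elim _ _ e₂ in inj₂ (eqᵇ-sound _ _ p , eqᵇ-sound _ _ q)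

isEdge-fwd : ∀ {n} (x y : Fin n) → isEdge x y x y ≡ true
isEdge-fwd x y rewrite eqᵇ-refl x | eqᵇ-refl y = refl

isEdge-bwd : ∀ {n} (x y : Fin n) → isEdge x y y x ≡ true
isEdge-bwd x y rewrite eqᵇ-refl x | eqᵇ-refl y = ∨-introʳ (eqᵇ y x ∧ eqᵇ x y) true refl

isEdge-sym : ∀ {n} (x y u v : Fin n) → isEdge x y u v ≡ true → isEdge x y v u ≡ true
isEdge-sym x y u v e with isEdge-elim x y u v e
... | inj₁ (refl , refl) = isEdge-bwd x y
... | inj₂ (refl , refl) = isEdge-fwd x y

isEdge-loop : ∀ {n} {x y : Fin n} u → isEdge x y u u ≡ true → x ≡ y
isEdge-loop {x = x} {y} u e with isEdge-elim x y u u e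
... | inj₁ (refl , refl) = refl
... | inj₂ (refl , refl) = refl

any-witness : ∀ {A : Set} (f : A → Bool) xs → any f xs ≡ true → ∃ λ x → f x ≡ true
any-witness f xs e =
  let (x , fx) = satisfied (any⁻ f xs (Equivalence.from T-≡ e)) in x , Equivalence.to T-≡ fx

any-allFin : ∀ {k} (f : Fin k → Bool) i → f i ≡ true → any f (allFin k) ≡ true
any-allFin f i e = Equivalence.to T-≡ (any⁺ f (lose (∈-allFin i) (Equivalence.from T-≡ e)))

count : ∀ {N} → (Fin N → Bool) → ℕ
count {zero}  h = 0
count {suc N} h = (if h Fin.zero then 1 else 0) + count (λ i → h (Fin.suc i))

count-tabulate : ∀ {N M} (h : Fin N → Bool) (g : Fin M → Fin N) →
  sum (map (λ v → if h v then 1 else 0) (tabulate g)) ≡ count (λ i → h (g i))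
count-tabulate {M = zero}  h g = refl
count-tabulate {M = suc M} h g =
  cong ((if h (g Fin.zero) then 1 else 0) +_) (count-tabulate h (λ i → g (Fin.suc i)))

degree≡count : ∀ {n} (A : Fin n → Fin n → Bool) u → degree A u ≡ count (A u)
degree≡count A u = count-tabulate (A u) (λ v → v)

count≡0 : ∀ {N} (h : Fin N → Bool) → count h ≡ 0 → ∀ z → ¬ h z ≡ true
count≡0 {suc N} h e z hz with h Fin.zero in h₀
count≡0 {suc N} h () z hz           | true
count≡0 {suc N} h e Fin.zero hz     | false with () ← trans (sym hz) h₀
count≡0 {suc N} h e (Fin.suc z) hz  | false = count≡0 (λ i → h (Fin.suc i)) e z hz

count≡1 : ∀ {N} (h : Fin N → Bool) → count h ≡ 1 →
          ∃ λ x → h x ≡ true × (∀ z → h z ≡ true → z ≡ x)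
count≡1 {zero} h ()
count≡1 {suc N} h e with h Fin.zero in h₀
... | true  = Fin.zero , h₀ , only
  where only : ∀ z → h z ≡ true → z ≡ Fin.zero
        only Fin.zero    _  = refl
        only (Fin.suc z) hz = ⊥-elim (count≡0 (λ i → h (Fin.suc i)) (cong pred e) z hz)
... | false with count≡1 (λ i → h (Fin.suc i)) e
...   | x , hx , unique = Fin.suc x , hx , only
  where only : ∀ z → h z ≡ true → z ≡ Fin.suc x
        only Fin.zero    hz with () ← trans (sym hz) h₀
        only (Fin.suc z) hz = cong Fin.suc (unique z hz)

record ExactlyTwo {n : ℕ} (P : Fin n → Set) : Set where
  field
    fst snd : Fin n
    fst≢snd : ¬ fst ≡ snd
    P-fst   : P fst
    P-snd   : P snd
    only    : ∀ z → P z → z ≡ fst ⊎ z ≡ snd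

count≡2 : ∀ {N} (h : Fin N → Bool) → count h ≡ 2 → ExactlyTwo (λ z → h z ≡ true)
count≡2 {zero} h ()
count≡2 {suc N} h e with h Fin.zero in h₀
... | true with count≡1 (λ i → h (Fin.suc i)) (cong pred e)
...   | x , hx , unique = record
  { fst = Fin.zero ; snd = Fin.suc x ; fst≢snd = λ () ; P-fst = h₀ ; P-snd = hx ; only = only }
  where only : ∀ z → h z ≡ true → z ≡ Fin.zero ⊎ z ≡ Fin.suc x
        only Fin.zero    _  = inj₁ refl
        only (Fin.suc z) hz = inj₂ (cong Fin.suc (unique z hz))
count≡2 {suc N} h e | false = record
  { fst = Fin.suc fst ; snd = Fin.suc snd ; fst≢snd = λ eq → fst≢snd (FinP.suc-injective eq)
  ; P-fst = P-fst ; P-snd = P-snd ; only = only′ }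
  where open ExactlyTwo (count≡2 (λ i → h (Fin.suc i)) e)
        only′ : ∀ z → h z ≡ true → z ≡ Fin.suc fst ⊎ z ≡ Fin.suc snd
        only′ Fin.zero    hz with () ← trans (sym hz) h₀
        only′ (Fin.suc z) hz with only z hz
        ... | inj₁ eq = inj₁ (cong Fin.suc eq)
        ... | inj₂ eq = inj₂ (cong Fin.suc eq)

twoFactor-neighbours : ∀ {n} (A : Fin n → Fin n → Bool) → TwoFactor A →
                       ∀ u → ExactlyTwo (λ v → A u v ≡ true)
twoFactor-neighbours A two u = count≡2 (A u) (trans (sym (degree≡count A u)) (two u))

least : {P : ℕ → Set} → (∀ k → Dec (P k)) → ∀ N → P N →
        ∃ λ j → P j × (∀ i → i < j → ¬ P i)
least {P} P? N = search N (<-wellFounded N)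
  where
  search : ∀ m → Acc _<_ m → P m → ∃ λ j → P j × (∀ i → i < j → ¬ P i)
  search m (acc smaller) Pm with anyUpTo? P? m
  ... | no none            = m , Pm , λ i i<m Pi → none (i , i<m , Pi)
  ... | yes (i , i<m , Pi) = search i (smaller i<m) Pi

suc-mod : ∀ t M .{{_ : NonZero M}} →
          (suc (t % M) < M × suc t % M ≡ suc (t % M)) ⊎ (t % M ≡ M ∸ 1 × suc t % M ≡ 0)
suc-mod t M with suc (t % M) <? M
... | yes lt = inj₁ (lt , trans (reduce t) (m<n⇒m%n≡m lt))
  where open ≡-Reasoning
        reduce : ∀ t → suc t % M ≡ suc (t % M) % M
        reduce t = begin
          suc t % M                        ≡⟨ cong (λ z → suc z % M) (m≡m%n+[m/n]*n t M) ⟩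
          (suc (t % M) + (t / M) * M) % M   ≡⟨ [m+kn]%n≡m%n (suc (t % M)) (t / M) M ⟩
          suc (t % M) % M                  ∎
... | no ¬lt = inj₂ (cong (_∸ 1) full , wraps)
  where open ≡-Reasoning
        full : suc (t % M) ≡ M
        full = ≤-antisym (m%n<n t M) (≮⇒≥ ¬lt)
        wraps : suc t % M ≡ 0
        wraps = begin
          suc t % M                        ≡⟨ cong (λ z → suc z % M) (m≡m%n+[m/n]*n t M) ⟩
          (suc (t % M) + (t / M) * M) % M   ≡⟨ [m+kn]%n≡m%n (suc (t % M)) (t / M) M ⟩
          suc (t % M) % M                  ≡⟨ cong (_% M) full ⟩
          M % M                            ≡⟨ n%n≡0 M ⟩
          0                                ∎

+-cancelʳ-mod : ∀ x y r M .{{_ : NonZero M}} → (x + r) % M ≡ (y + r) % M → x % M ≡ y % M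
+-cancelʳ-mod x y r M@(suc m) eq = begin
    x % M                              ≡⟨ shift x ⟩
    ((x + r) % M + (r * m) % M) % M    ≡⟨ cong (λ z → (z + (r * m) % M) % M) eq ⟩
    ((y + r) % M + (r * m) % M) % M    ≡⟨ sym (shift y) ⟩
    y % M                              ∎
  where
  open ≡-Reasoning
  -- x ≡ (x + r) + r * m  modulo M, since r + r * m = r * M
  shift : ∀ x → x % M ≡ ((x + r) % M + (r * m) % M) % M
  shift x = begin
    x % M                              ≡⟨ sym ([m+kn]%n≡m%n x r M) ⟩
    (x + r * M) % M                    ≡⟨ cong (λ z → (x + z) % M) (*-suc r m) ⟩
    (x + (r + r * m)) % M              ≡⟨ cong (_% M) (sym (+-assoc x r (r * m))) ⟩
    ((x + r) + r * m) % M              ≡⟨ %-distribˡ-+ (x + r) (r * m) M ⟩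
    ((x + r) % M + (r * m) % M) % M    ∎

%-absorbˡ-+ : ∀ x r M .{{_ : NonZero M}} → (x % M + r) % M ≡ (x + r) % M
%-absorbˡ-+ x r M = begin
    (x % M + r) % M           ≡⟨ %-distribˡ-+ (x % M) r M ⟩
    (x % M % M + r % M) % M   ≡⟨ cong (λ z → (z + r % M) % M) (m%n%n≡m%n x M) ⟩
    (x % M + r % M) % M       ≡⟨ sym (%-distribˡ-+ x r M) ⟩
    (x + r) % M               ∎
  where open ≡-Reasoning

-- Cycles in a relation, as periodic sequences of vertices.

module Cycles {n : ℕ} where

  -- A cycle of length suc last in R: a sequence of period suc last whose
  -- entries within one period are distinct and whose consecutive entries
  -- are R-related (in particular at last is related to at 0).
  record Cycle (R : Fin n → Fin n → Set) : Set where
    field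
      last     : ℕ
      at       : ℕ → Fin n
      periodic : ∀ t → at t ≡ at (t % suc last)
      linked   : ∀ t → R (at t) (at (suc t))
      distinct : ∀ t t′ → at t ≡ at t′ → t % suc last ≡ t′ % suc last
  open Cycle public

  mapCycle : {R R′ : Fin n → Fin n → Set} → (∀ {u v} → R u v → R′ u v) → Cycle R → Cycle R′
  mapCycle f C = record
    { last = last C ; at = at C ; periodic = periodic C ; linked = λ t → f (linked C t) ; distinct = distinct C }

  module _ {R : Fin n → Fin n → Set} where

    _∈C_ : Fin n → Cycle R → Set
    x ∈C C = ∃ λ t → at C t ≡ x

    Edge : Cycle R → Fin n → Fin n → Set
    Edge C u v = ∃ λ t → at C t ≡ u × at C (suc t) ≡ v

    at-cong-mod : (C : Cycle R) → ∀ t t′ → t % suc (last C) ≡ t′ % suc (last C) → at C t ≡ at C t′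
    at-cong-mod C t t′ eq = trans (periodic C t) (trans (cong (at C) eq) (sym (periodic C t′)))

    at-period : (C : Cycle R) → ∀ t r → at C (t + r * suc (last C)) ≡ at C t
    at-period C t r = at-cong-mod C _ _ ([m+kn]%n≡m%n t r (suc (last C)))

    at-injective : (C : Cycle R) → ∀ {t t′} → t < suc (last C) → t′ < suc (last C) →
                   at C t ≡ at C t′ → t ≡ t′
    at-injective C t< t′< eq =
      trans (sym (m<n⇒m%n≡m t<)) (trans (distinct C _ _ eq) (m<n⇒m%n≡m t′<))

    _∈C?_ : ∀ x (C : Cycle R) → Dec (x ∈C C)
    x ∈C? C with anyUpTo? (λ t → at C t ≟F x) (suc (last C))
    ... | yes (t , _ , eq) = yes (t , eq)
    ... | no none = no λ (t , eq) →
            none (t % suc (last C) , m%n<n t (suc (last C)) , trans (sym (periodic C t)) eq)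

    length≤n : (C : Cycle R) → suc (last C) ≤ n
    length≤n C = FinP.injective⇒≤ {f = λ i → at C (toℕ i)}
      λ {i} {j} eq → FinP.toℕ-injective (at-injective C (FinP.toℕ<n i) (FinP.toℕ<n j) eq)

    spanning⇒n≤length : (C : Cycle R) → (∀ x → x ∈C C) → n ≤ suc (last C)
    spanning⇒n≤length C all = FinP.injective⇒≤ {f = position} position-injective
      where
      position : Fin n → Fin (suc (last C))
      position x = fromℕ< (m%n<n (proj₁ (all x)) (suc (last C)))
      position-injective : ∀ {x y} → position x ≡ position y → x ≡ y
      position-injective {x} {y} eq =
        trans (sym (proj₂ (all x))) (trans (at-cong-mod C _ _ same-residue) (proj₂ (all y)))
        where
        same-residue : proj₁ (all x) % suc (last C) ≡ proj₁ (all y) % suc (last C)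
        same-residue = FinP.fromℕ<-injective _ _ _ _ eq

    missing-vertex : (C : Cycle R) → ¬ n ≤ suc (last C) → ∃ λ x → ¬ x ∈C C
    missing-vertex C short with FinP.any? (λ x → ¬? (x ∈C? C))
    ... | yes found = found
    ... | no none   = ⊥-elim (short (spanning⇒n≤length C λ x →
                        decidable-stable (x ∈C? C) (λ x∉C → none (x , x∉C))))

    rotate : Cycle R → ℕ → Cycle R
    rotate C r = record
      { last = last C ; at = λ t → at C (t + r)
      ; periodic = λ t → at-cong-mod C _ _ (sym (%-absorbˡ-+ t r (suc (last C))))
      ; linked = λ t → linked C (t + r)
      ; distinct = λ t t′ eq → +-cancelʳ-mod t t′ r (suc (last C)) (distinct C _ _ eq) }

    rotate-back : (C : Cycle R) → ∀ t r → at C ((t + last C * r) + r) ≡ at C t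
    rotate-back C t r = trans (cong (at C) full-turns) (at-period C t r)
      where
      full-turns : (t + last C * r) + r ≡ t + r * suc (last C)
      full-turns = begin
        (t + last C * r) + r   ≡⟨ +-assoc t _ r ⟩
        t + (last C * r + r)   ≡⟨ cong (t +_) (+-comm (last C * r) r) ⟩
        t + (r + last C * r)   ≡⟨ cong (λ z → t + (r + z)) (*-comm (last C) r) ⟩
        t + (r + r * last C)   ≡⟨ cong (t +_) (sym (*-suc r (last C))) ⟩
        t + r * suc (last C)   ∎
        where open ≡-Reasoning

    rotate-∈ : (C : Cycle R) → ∀ r {x} → x ∈C C → x ∈C rotate C r
    rotate-∈ C r (t , eq) = t + last C * r , trans (rotate-back C t r) eq

    rotate-∈⁻ : (C : Cycle R) → ∀ r {x} → x ∈C rotate C r → x ∈C C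
    rotate-∈⁻ C r (t , eq) = t + r , eq

    rotate-Edge : (C : Cycle R) → ∀ r {u v} → Edge C u v → Edge (rotate C r) u v
    rotate-Edge C r (t , eu , ev) =
      t + last C * r , trans (rotate-back C t r) eu , trans (rotate-back C (suc t) r) ev

    rotate-last : (C : Cycle R) → ∀ t → at (rotate C (suc t)) (last C) ≡ at C t
    rotate-last C t = trans (cong (at C) one-turn) (at-period C t 1)
      where
      one-turn : last C + suc t ≡ t + 1 * suc (last C)
      one-turn = trans (+-comm (last C) (suc t))
                   (trans (sym (+-suc t (last C))) (cong (t +_) (sym (+-identityʳ (suc (last C))))))

open Cycles

module Concatenation {n : ℕ} {R : Fin n → Fin n → Set} (L W : Cycle R)
         (disjoint : ∀ t t′ → ¬ at L t ≡ at W t′)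
         (L→W : R (at L (last L)) (at W 0)) (W→L : R (at W (last W)) (at L 0)) where

  private
    mL mW M : ℕ
    mL = suc (last L)
    mW = suc (last W)
    M  = mL + mW

  join : ℕ → Fin n
  join t with t <? mL
  ... | yes _ = at L t
  ... | no _  = at W (t ∸ mL)

  join-L : ∀ {t} → t < mL → join t ≡ at L t
  join-L {t} lt with t <? mL
  ... | yes _  = refl
  ... | no ¬lt = ⊥-elim (¬lt lt)

  join-W : ∀ {t} → mL ≤ t → join t ≡ at W (t ∸ mL)
  join-W {t} le with t <? mL
  ... | yes lt = ⊥-elim (<⇒≱ lt le)
  ... | no _   = refl

  join-linked : ∀ t → suc t < M → R (join t) (join (suc t))
  join-linked t _ = by-cases (suc t <? mL) (t <? mL)
   where
   by-cases : Dec (suc t < mL) → Dec (t < mL) → R (join t) (join (suc t))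
   by-cases (yes st<mL) _ =
    subst₂ R (sym (join-L (<-trans (n<1+n t) st<mL))) (sym (join-L st<mL)) (linked L t)
   by-cases (no st≮mL) (yes t<mL) =
     subst₂ R (sym (join-L t<mL)) (sym (trans (join-W (≮⇒≥ st≮mL)) (cong (at W) start)))
       (subst (λ z → R (at L z) (at W 0)) (sym t≡last) L→W)
     where
     t≡last : t ≡ last L
     t≡last = ≤-antisym (s≤s⁻¹ t<mL) (s≤s⁻¹ (≮⇒≥ st≮mL))
     start : suc t ∸ mL ≡ 0
     start = trans (cong (λ z → suc z ∸ mL) t≡last) (n∸n≡0 mL)
   by-cases (no st≮mL) (no t≮mL) =
    subst₂ R (sym (join-W (≮⇒≥ t≮mL)))
      (sym (trans (join-W (≮⇒≥ st≮mL)) (cong (at W) (+-∸-assoc 1 (≮⇒≥ t≮mL)))))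
      (linked W (t ∸ mL))

  join-wrap : R (join (last L + mW)) (join 0)
  join-wrap = subst₂ R (sym (trans (join-W mL≤end) (cong (at W) end∸mL))) (sym (join-L (s≤s z≤n))) W→L
    where
    mL≤end : mL ≤ last L + mW
    mL≤end = subst (mL ≤_) (sym (+-suc (last L) (last W))) (s≤s (m≤m+n (last L) (last W)))
    end∸mL : last L + mW ∸ mL ≡ last W
    end∸mL = trans (cong (_∸ mL) (+-suc (last L) (last W))) (m+n∸m≡n (last L) (last W))

  join-injective : ∀ {t t′} → t < M → t′ < M → join t ≡ join t′ → t ≡ t′
  join-injective {t} {t′} t< t′< eq = by-cases (t <? mL) (t′ <? mL)
   where
   by-cases : Dec (t < mL) → Dec (t′ < mL) → t ≡ t′
   by-cases (yes lt) (yes lt′) = at-injective L lt lt′ (trans (sym (join-L lt)) (trans eq (join-L lt′)))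
   by-cases (yes lt) (no ¬lt′) = ⊥-elim (disjoint t _ (trans (sym (join-L lt)) (trans eq (join-W (≮⇒≥ ¬lt′)))))
   by-cases (no ¬lt) (yes lt′) = ⊥-elim (disjoint t′ _ (trans (sym (join-L lt′)) (trans (sym eq) (join-W (≮⇒≥ ¬lt)))))
   by-cases (no ¬lt) (no ¬lt′) =
     trans (sym (m∸n+n≡m (≮⇒≥ ¬lt))) (trans (cong (_+ mL) on-W) (m∸n+n≡m (≮⇒≥ ¬lt′)))
     where
     on-W : t ∸ mL ≡ t′ ∸ mL
     on-W = at-injective W (m<n+o⇒m∸n<o t mL t<) (m<n+o⇒m∸n<o t′ mL t′<)
              (trans (sym (join-W (≮⇒≥ ¬lt))) (trans eq (join-W (≮⇒≥ ¬lt′))))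

  concat : Cycle R
  concat = record
    { last = last L + mW ; at = λ t → join (t % M)
    ; periodic = λ t → cong join (sym (m%n%n≡m%n t M))
    ; linked = linked′ ; distinct = λ t t′ → join-injective (m%n<n t M) (m%n<n t′ M) }
    where
    linked′ : ∀ t → R (join (t % M)) (join (suc t % M))
    linked′ t with suc-mod t M
    ... | inj₁ (lt , eq)    = subst (λ z → R (join (t % M)) (join z)) (sym eq) (join-linked (t % M) lt)
    ... | inj₂ (eq₁ , eq₂) = subst₂ (λ z z′ → R (join z) (join z′)) (sym eq₁) (sym eq₂) join-wrap

  concat-L : ∀ {t} → t < mL → at concat t ≡ at L t
  concat-L lt = trans (cong join (m<n⇒m%n≡m (≤-trans lt (m≤m+n mL mW)))) (join-L lt)

  concat-W : ∀ {r} → r < mW → at concat (mL + r) ≡ at W r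
  concat-W {r} lt = trans (cong join (m<n⇒m%n≡m (+-monoʳ-< mL lt)))
                      (trans (join-W (m≤m+n mL r)) (cong (at W) (m+n∸m≡n mL r)))

  concat-∈⁻ : ∀ {x} → x ∈C concat → x ∈C L ⊎ x ∈C W
  concat-∈⁻ {x} (t , eq) = by-cases ((t % M) <? mL)
    where
    by-cases : Dec (t % M < mL) → x ∈C L ⊎ x ∈C W
    by-cases (yes lt) = inj₁ (t % M , trans (sym (join-L lt)) eq)
    by-cases (no ¬lt) = inj₂ (t % M ∸ mL , trans (sym (join-W (≮⇒≥ ¬lt))) eq)

  concat-∈L : ∀ {x} → x ∈C L → x ∈C concat
  concat-∈L (t , eq) = t % mL , trans (concat-L (m%n<n t mL)) (trans (sym (periodic L t)) eq)

  concat-∈W : ∀ {x} → x ∈C W → x ∈C concat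
  concat-∈W (t , eq) = mL + t % mW , trans (concat-W (m%n<n t mW)) (trans (sym (periodic W t)) eq)

  concat-EdgeL : ∀ {u v} → Edge L u v → Edge concat u v ⊎ (u ≡ at L (last L) × v ≡ at L 0)
  concat-EdgeL {u} {v} (t , eu , ev) with suc-mod t mL
  ... | inj₁ (lt , eq) = inj₁ (t % mL , trans (concat-L (m%n<n t mL)) (trans (sym (periodic L t)) eu)
                                      , trans (concat-L lt) (trans (cong (at L) (sym eq)) (trans (sym (periodic L (suc t))) ev)))
  ... | inj₂ (t≡ , eq) = inj₂ (trans (sym eu) (trans (periodic L t) (cong (at L) t≡))
                              , trans (sym ev) (trans (periodic L (suc t)) (cong (at L) eq)))

  concat-EdgeW : ∀ {u v} → Edge W u v → Edge concat u v ⊎ (u ≡ at W (last W) × v ≡ at W 0)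
  concat-EdgeW {u} {v} (t , eu , ev) with suc-mod t mW
  ... | inj₁ (lt , eq) = inj₁ (mL + t % mW , trans (concat-W (m%n<n t mW)) (trans (sym (periodic W t)) eu)
                              , trans (cong (at concat) (sym (+-suc mL (t % mW))))
                                  (trans (concat-W lt) (trans (cong (at W) (sym eq)) (trans (sym (periodic W (suc t))) ev))))
  ... | inj₂ (t≡ , eq) = inj₂ (trans (sym eu) (trans (periodic W t) (cong (at W) t≡))
                              , trans (sym ev) (trans (periodic W (suc t)) (cong (at W) eq)))

-- Splicing two disjoint cycles L ∋ x→x′ and W ∋ y′→y along links x→y and
-- y′→x′: the cycle x′ … x y … y′ uses every edge of L and W except x→x′
-- and y′→y, and meets exactly the vertices of L and W.
record Splice {n : ℕ} {R : Fin n → Fin n → Set} (L W : Cycle R) (x x′ y y′ : Fin n) : Set where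
  field
    cycle  : Cycle R
    ∈L     : ∀ {z} → z ∈C L → z ∈C cycle
    ∈W     : ∀ {z} → z ∈C W → z ∈C cycle
    ∈⁻     : ∀ {z} → z ∈C cycle → z ∈C L ⊎ z ∈C W
    EdgeL  : ∀ {u v} → Edge L u v → Edge cycle u v ⊎ (u ≡ x × v ≡ x′)
    EdgeW  : ∀ {u v} → Edge W u v → Edge cycle u v ⊎ (u ≡ y′ × v ≡ y)
    longer : suc (last L) ≤ last cycle

splice : ∀ {n} {R : Fin n → Fin n → Set} (L W : Cycle R) {x x′ y y′ : Fin n} →
         (∀ t t′ → ¬ at L t ≡ at W t′) →
         Edge L x x′ → Edge W y′ y → R x y → R y′ x′ → Splice L W x x′ y y′
splice {R = R} L W {x} {x′} {y} {y′} disjoint (j , ex , ex′) (j′ , ey′ , ey) x→y y′→x′ = record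
  { cycle = concat ; ∈L = λ m → concat-∈L (rotate-∈ L (suc j) m) ; ∈W = λ m → concat-∈W (rotate-∈ W (suc j′) m)
  ; ∈⁻ = ∈⁻ ; EdgeL = EdgeL ; EdgeW = EdgeW
  ; longer = subst (suc (last L) ≤_) (sym (+-suc (last L) (last W))) (s≤s (m≤m+n (last L) (last W))) }
  where
  -- L from x′ round to x, and W from y round to y′.
  L′ W′ : Cycle R
  L′ = rotate L (suc j)
  W′ = rotate W (suc j′)
  L′-last : at L′ (last L) ≡ x
  L′-last = trans (rotate-last L j) ex
  W′-last : at W′ (last W) ≡ y′
  W′-last = trans (rotate-last W j′) ey′
  open Concatenation L′ W′ (λ t t′ → disjoint (t + suc j) (t′ + suc j′))
         (subst₂ R (sym L′-last) (sym ey) x→y) (subst₂ R (sym W′-last) (sym ex′) y′→x′)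
  ∈⁻ : ∀ {z} → z ∈C concat → z ∈C L ⊎ z ∈C W
  ∈⁻ m with concat-∈⁻ m
  ... | inj₁ mL = inj₁ (rotate-∈⁻ L (suc j) mL)
  ... | inj₂ mW = inj₂ (rotate-∈⁻ W (suc j′) mW)
  EdgeL : ∀ {u v} → Edge L u v → Edge concat u v ⊎ (u ≡ x × v ≡ x′)
  EdgeL e with concat-EdgeL (rotate-Edge L (suc j) e)
  ... | inj₁ e′         = inj₁ e′
  ... | inj₂ (eu , ev) = inj₂ (trans eu L′-last , trans ev ex′)
  EdgeW : ∀ {u v} → Edge W u v → Edge concat u v ⊎ (u ≡ y′ × v ≡ y)
  EdgeW e with concat-EdgeW (rotate-Edge W (suc j′) e)
  ... | inj₁ e′         = inj₁ e′
  ... | inj₂ (eu , ev) = inj₂ (trans eu W′-last , trans ev ey)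

-- Closed walks in a 2-regular relation: following the neighbour one did not
-- come from eventually returns to the starting edge, tracing a cycle that
-- contains every edge at each of its vertices.

module TwoRegular {n : ℕ} (F : Fin n → Fin n → Set)
         (F-sym : ∀ {u v} → F u v → F v u) (F-irrefl : ∀ u → ¬ F u u)
         (neighbours : ∀ u → ExactlyTwo (F u)) where

  open ExactlyTwo

  other : Fin n → Fin n → Fin n
  other u q with q ≟F fst (neighbours u)
  ... | yes _ = snd (neighbours u)
  ... | no _  = fst (neighbours u)

  other-adj : ∀ u q → F u (other u q)
  other-adj u q with q ≟F fst (neighbours u)
  ... | yes _ = P-snd (neighbours u)
  ... | no _  = P-fst (neighbours u)

  other-≢ : ∀ {u q} → F u q → ¬ other u q ≡ q
  other-≢ {u} {q} _ with q ≟F fst (neighbours u)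
  ... | yes q≡fst = λ eq → fst≢snd (neighbours u) (sym (trans eq q≡fst))
  ... | no q≢fst  = λ eq → q≢fst (sym eq)

  other-cover : ∀ {u q z} → F u q → F u z → z ≡ q ⊎ z ≡ other u q
  other-cover {u} {q} {z} Fq Fz with q ≟F fst (neighbours u) | only (neighbours u) z Fz
  ... | yes q≡fst | inj₁ z≡fst = inj₁ (trans z≡fst (sym q≡fst))
  ... | yes _     | inj₂ z≡snd = inj₂ z≡snd
  ... | no _      | inj₁ z≡fst = inj₂ z≡fst
  ... | no q≢fst  | inj₂ z≡snd with only (neighbours u) q Fq
  ...   | inj₁ q≡fst = ⊥-elim (q≢fst q≡fst)
  ...   | inj₂ q≡snd = inj₁ (trans z≡snd (sym q≡snd))

  other-involutive : ∀ {u q} → F u q → other u (other u q) ≡ q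
  other-involutive {u} {q} Fq with other-cover (other-adj u q) Fq
  ... | inj₁ q≡other = ⊥-elim (other-≢ Fq (sym q≡other))
  ... | inj₂ q≡other² = sym q≡other²

  module ClosedWalk (y₀ y₁ : Fin n) (y₀y₁ : F y₀ y₁) where

    state : ℕ → Fin n × Fin n
    state zero    = y₀ , y₁
    state (suc k) = proj₂ (state k) , other (proj₂ (state k)) (proj₁ (state k))

    walk : ℕ → Fin n
    walk k = proj₁ (state k)

    walk-linked : ∀ k → F (walk k) (walk (suc k))
    walk-linked zero    = y₀y₁
    walk-linked (suc k) = other-adj (walk (suc k)) (walk k)

    no-backtrack : ∀ k → ¬ walk (suc (suc k)) ≡ walk k
    no-backtrack k = other-≢ (F-sym (walk-linked k))

    Repeats : ℕ → Set
    Repeats j = ∃ λ i → i < j × walk i ≡ walk j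

    some-repeat : ∃ λ N → Repeats N
    some-repeat with FinP.pigeonhole (n<1+n n) (λ i → walk (toℕ i))
    ... | i , j , i<j , eq = toℕ j , toℕ i , i<j , eq

    first-repeat : ∃ λ j → Repeats j × (∀ i → i < j → ¬ Repeats i)
    first-repeat = least (λ j → anyUpTo? (λ i → walk i ≟F walk j) j) (proj₁ some-repeat) (proj₂ some-repeat)

    period : ℕ
    period = proj₁ first-repeat

    period-repeats : Repeats period
    period-repeats = proj₁ (proj₂ first-repeat)

    walk-distinct : ∀ {i j} → i < j → j < period → ¬ walk i ≡ walk j
    walk-distinct i<j j<period eq = proj₂ (proj₂ first-repeat) _ j<period (_ , i<j , eq)

    returns-to-start : ∀ {i j} → j ≡ period → i < j → walk i ≡ walk j → i ≡ 0
    returns-to-start {zero} _ _ _ = refl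
    returns-to-start {suc i} {suc j} j≡period i<j eq
      with other-cover (F-sym (walk-linked i)) (subst (λ z → F z (walk j)) (sym eq) (F-sym (walk-linked j)))
    ... | inj₁ j-at-i = ⊥-elim (walk-distinct (s<s⁻¹ i<j) j<period (sym j-at-i))
      where
      j<period : j < period
      j<period = subst (j <_) j≡period (n<1+n j)
    ... | inj₂ j-after with <-cmp (suc (suc i)) j
    ...   | tri< lt _ _ = ⊥-elim (walk-distinct lt (subst (j <_) j≡period (n<1+n j)) (sym j-after))
    ...   | tri≈ _ refl _ = ⊥-elim (no-backtrack (suc i) (sym eq))
    ...   | tri> _ _ gt = ⊥-elim (F-irrefl (walk (suc i))
                              (subst (F (walk (suc i))) (trans (sym j-after) (cong walk j≡suc-i)) (walk-linked (suc i))))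
      where
      j≡suc-i : j ≡ suc i
      j≡suc-i = ≤-antisym (s≤s⁻¹ gt) (s<s⁻¹ i<j)

    period-returns : walk period ≡ y₀
    period-returns with period-repeats
    ... | i , i<period , eq = sym (subst (λ z → walk z ≡ walk period) (returns-to-start refl i<period eq) eq)

    state-period : state period ≡ state 0
    state-period = closes period refl
      where
      closes : ∀ j → j ≡ period → state j ≡ state 0
      closes zero j≡period with subst Repeats (sym j≡period) period-repeats
      ... | _ , () , _
      closes (suc zero) j≡period =
        ⊥-elim (F-irrefl y₀ (subst (F y₀) (trans (cong walk j≡period) period-returns) y₀y₁))
      closes (suc (suc zero)) j≡period =
        ⊥-elim (no-backtrack 0 (trans (cong walk j≡period) period-returns))
      closes (suc (suc (suc j))) j≡period = closing (other-cover y₀y₁ y₀-before)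
        where
        back : walk (suc (suc (suc j))) ≡ y₀
        back = trans (cong walk j≡period) period-returns
        y₀-before : F y₀ (walk (suc (suc j)))
        y₀-before = subst (λ z → F z (walk (suc (suc j)))) back (F-sym (walk-linked (suc (suc j))))
        closing : walk (suc (suc j)) ≡ y₁ ⊎ walk (suc (suc j)) ≡ other y₀ y₁ → state (suc (suc (suc j))) ≡ state 0
        closing (inj₁ at-y₁)    =
          ⊥-elim (walk-distinct (s≤s (s≤s z≤n)) (subst (suc (suc j) <_) j≡period (n<1+n _)) (sym at-y₁))
        closing (inj₂ at-other) = cong₂ _,_ back (trans (cong₂ other back at-other) (other-involutive y₀y₁))

    state-periodic : ∀ k → state (k + period) ≡ state k
    state-periodic zero    = state-period
    state-periodic (suc k) = cong (λ s → proj₂ s , other (proj₂ s) (proj₁ s)) (state-periodic k)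

    walk-periodic : ∀ t r → walk (t + r * period) ≡ walk t
    walk-periodic t zero    = cong walk (+-identityʳ t)
    walk-periodic t (suc r) = begin
      walk (t + (period + r * period))   ≡⟨ cong walk (cong (t +_) (+-comm period (r * period))) ⟩
      walk (t + (r * period + period))   ≡⟨ cong walk (sym (+-assoc t (r * period) period)) ⟩
      walk ((t + r * period) + period)   ≡⟨ cong proj₁ (state-periodic (t + r * period)) ⟩
      walk (t + r * period)              ≡⟨ walk-periodic t r ⟩
      walk t                             ∎
      where open ≡-Reasoning

    period≡suc : period ≡ suc (pred period)
    period≡suc with period | period-repeats
    ... | zero  | _ , () , _
    ... | suc _ | _ = refl

    cycle : Cycle F
    cycle = record { last = pred period ; at = walk ; periodic = periodic′ ; linked = walk-linked ; distinct = distinct′ }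
      where
      P : ℕ
      P = suc (pred period)
      periodic′ : ∀ t → walk t ≡ walk (t % P)
      periodic′ t = trans (cong walk (m≡m%n+[m/n]*n t P))
                      (trans (cong (λ z → walk (t % P + (t / P) * z)) (sym period≡suc)) (walk-periodic (t % P) (t / P)))
      below : ∀ t → t % P < period
      below t = subst (t % P <_) (sym period≡suc) (m%n<n t P)
      distinct′ : ∀ t t′ → walk t ≡ walk t′ → t % P ≡ t′ % P
      distinct′ t t′ eq with <-cmp (t % P) (t′ % P)
      ... | tri< lt _ _ = ⊥-elim (walk-distinct lt (below t′) (trans (sym (periodic′ t)) (trans eq (periodic′ t′))))
      ... | tri≈ _ same _ = same
      ... | tri> _ _ gt = ⊥-elim (walk-distinct gt (below t) (trans (sym (periodic′ t′)) (trans (sym eq) (periodic′ t))))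

    after-predecessor : ∀ t → walk (suc (t + pred period)) ≡ walk t
    after-predecessor t =
      trans (cong walk (trans (sym (+-suc t (pred period))) (cong (t +_) (sym period≡suc))))
            (cong proj₁ (state-periodic t))

    cycle-closed : ∀ {u v} → u ∈C cycle → F u v → Edge cycle u v ⊎ Edge cycle v u
    cycle-closed {u} {v} (t , eq) uv = by-cases (other-cover (F-sym (walk-linked before)) at-u-v)
      where
      before : ℕ
      before = t + pred period
      at-u : walk (suc before) ≡ u
      at-u = trans (after-predecessor t) eq
      at-u-v : F (walk (suc before)) v
      at-u-v = subst (λ z → F z v) (sym at-u) uv
      by-cases : v ≡ walk before ⊎ v ≡ walk (suc (suc before)) → Edge cycle u v ⊎ Edge cycle v u
      by-cases (inj₁ v-before) = inj₂ (before , sym v-before , at-u)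
      by-cases (inj₂ v-after)  = inj₁ (suc before , at-u , sym v-after)

Adj : ∀ {n} → Graph n → Fin n → Fin n → Set
Adj G u v = adj G u v ≡ true

_++W_ : ∀ {n} {G : Graph n} {x y z} → Walk G x y → Walk G y z → Walk G x z
here       ++W q = q
step e rest ++W q = step e (rest ++W q)

reverseW : ∀ {n} {G : Graph n} {x y} → Walk G x y → Walk G y x
reverseW here = here
reverseW {G = G} (step {u = u} {w = w} e rest) = reverseW rest ++W step (trans (Graph.sym G w u) e) here

leaving-edge : ∀ {n} (G : Graph n) {In : Fin n → Set} → (∀ x → Dec (In x)) →
               ∀ {x y} → Walk G x y → In x → ¬ In y →
               Σ (Fin n) λ u → Σ (Fin n) λ v → In u × ¬ In v × Adj G u v
leaving-edge G In? here              x∈ y∉ = ⊥-elim (y∉ x∈)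
leaving-edge G In? (step {w = w} e rest) x∈ y∉ with In? w
... | yes w∈ = leaving-edge G In? rest w∈ y∉
... | no w∉  = _ , w , x∈ , w∉ , e

injective⇒onto : ∀ {n} {σ : Fin n → Fin n} → Injective _≡_ _≡_ σ → ∀ v → ∃ λ i → σ i ≡ v
injective⇒onto {n} {σ} σ-inj v with FinP.any? (λ i → σ i ≟F v)
... | yes hit = hit
... | no miss = ⊥-elim (1+n≰n (FinP.injective⇒≤ {f = extend} extend-inj))
  where
  -- v together with the image of σ would be n + 1 distinct points.
  extend : Fin (suc n) → Fin n
  extend Fin.zero    = v
  extend (Fin.suc i) = σ i
  extend-inj : ∀ {i j} → extend i ≡ extend j → i ≡ j
  extend-inj {Fin.zero}  {Fin.zero}  _  = refl
  extend-inj {Fin.zero}  {Fin.suc j} eq = ⊥-elim (miss (j , sym eq))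
  extend-inj {Fin.suc i} {Fin.zero}  eq = ⊥-elim (miss (i , eq))
  extend-inj {Fin.suc i} {Fin.suc j} eq = cong Fin.suc (σ-inj eq)

three-distinct⇒3≤n : ∀ {n} {x y z : Fin n} → ¬ x ≡ y → ¬ x ≡ z → ¬ y ≡ z → 3 ≤ n
three-distinct⇒3≤n {n} {x} {y} {z} x≢y x≢z y≢z = FinP.injective⇒≤ {f = pick} pick-inj
  where
  pick : Fin 3 → Fin n
  pick Fin.zero                       = x
  pick (Fin.suc Fin.zero)             = y
  pick (Fin.suc (Fin.suc Fin.zero))   = z
  pick-inj : ∀ {i j} → pick i ≡ pick j → i ≡ j
  pick-inj {Fin.zero}                     {Fin.zero}                     _  = refl
  pick-inj {Fin.zero}                     {Fin.suc Fin.zero}             eq = ⊥-elim (x≢y eq)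
  pick-inj {Fin.zero}                     {Fin.suc (Fin.suc Fin.zero)}   eq = ⊥-elim (x≢z eq)
  pick-inj {Fin.suc Fin.zero}             {Fin.zero}                     eq = ⊥-elim (x≢y (sym eq))
  pick-inj {Fin.suc Fin.zero}             {Fin.suc Fin.zero}             _  = refl
  pick-inj {Fin.suc Fin.zero}             {Fin.suc (Fin.suc Fin.zero)}   eq = ⊥-elim (y≢z eq)
  pick-inj {Fin.suc (Fin.suc Fin.zero)}   {Fin.zero}                     eq = ⊥-elim (x≢z (sym eq))
  pick-inj {Fin.suc (Fin.suc Fin.zero)}   {Fin.suc Fin.zero}             eq = ⊥-elim (y≢z (sym eq))
  pick-inj {Fin.suc (Fin.suc Fin.zero)}   {Fin.suc (Fin.suc Fin.zero)}   _  = refl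

spanning-cycle⇒hamiltonian : ∀ {n} (G : Graph n) (C : Cycle (Adj G)) → suc (last C) ≡ n → 3 ≤ n → Hamiltonian G
spanning-cycle⇒hamiltonian {n} G C length≡n 3≤n = 3≤n , σ , σ-inj , σ-adj
  where
  σ : Fin n → Fin n
  σ i = at C (toℕ i)
  below : ∀ (i : Fin n) → toℕ i < suc (last C)
  below i = subst (toℕ i <_) (sym length≡n) (FinP.toℕ<n i)
  σ-inj : Injective _≡_ _≡_ σ
  σ-inj {i} {j} eq = FinP.toℕ-injective (at-injective C (below i) (below j) eq)
  closing : Adj G (at C (last C)) (at C 0)
  closing = subst (Adj G (at C (last C))) (trans (cong (at C) (sym (+-identityʳ (suc (last C))))) (at-period C 0 1))
              (linked C (last C))
  σ-adj : ∀ i j → (toℕ j ≡ suc (toℕ i) ⊎ (toℕ i ≡ n ∸ 1 × toℕ j ≡ 0)) → Adj G (σ i) (σ j)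
  σ-adj i j (inj₁ j≡i+1)      = subst (λ t → Adj G (σ i) (at C t)) (sym j≡i+1) (linked C (toℕ i))
  σ-adj i j (inj₂ (i≡ , j≡0)) = subst₂ (λ t t′ → Adj G (at C t) (at C t′)) (sym i≡last) (sym j≡0) closing
    where
    i≡last : toℕ i ≡ last C
    i≡last = trans i≡ (cong (_∸ 1) (sym length≡n))

-- A Hamiltonian graph is connected: every vertex is reached from σ(0)
-- along the cycle.
hamiltonian⇒connected : ∀ {n} (G : Graph n) → Hamiltonian G → Connected G
hamiltonian⇒connected {n} G (3≤n , σ , σ-inj , σ-adj) = 1≤n , λ u v → reverseW (from-start u) ++W from-start v
  where
  1≤n : 1 ≤ n
  1≤n = ≤-trans (s≤s z≤n) 3≤n
  start : Fin n
  start = fromℕ< 1≤n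
  along : ∀ t (t<n : t < n) → Walk G (σ start) (σ (fromℕ< t<n))
  along zero    _   = here
  along (suc t) t<n = along t t′<n ++W step (σ-adj (fromℕ< t′<n) (fromℕ< t<n) (inj₁ consecutive)) here
    where
    t′<n : t < n
    t′<n = <-trans (n<1+n t) t<n
    consecutive : toℕ (fromℕ< t<n) ≡ suc (toℕ (fromℕ< t′<n))
    consecutive = trans (FinP.toℕ-fromℕ< t<n) (cong suc (sym (FinP.toℕ-fromℕ< t′<n)))
  from-start : ∀ v → Walk G (σ start) v
  from-start v with injective⇒onto σ-inj v
  ... | i , σi≡v = subst (Walk G (σ start)) (trans (cong σ (FinP.fromℕ<-toℕ i (FinP.toℕ<n i))) σi≡v)
                     (along (toℕ i) (FinP.toℕ<n i))

-- The halved graph of an edge-disjoint union of 4-cycles and E, and the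
-- growth of saturated cycles.

module Halving {n k : ℕ} (G : Graph n) (sq : Fin k → Square n) (E : Graph n)
                 (union : EdgeDisjointUnion G sq E) (two-factor : TwoFactor (halvedAdj sq E)) where

  F : Fin n → Fin n → Set
  F u v = halvedAdj sq E u v ≡ true

  -- Kept i u v: {u,v} is one of the edges bc, da of the i-th square that
  -- survive halving (a record, so that i, u, v can be inferred).
  record Kept (i : Fin k) (u v : Fin n) : Set where
    constructor kept
    field holds : halfEdge (sq i) u v ≡ true

  CycleG : Set
  CycleG = Cycle (Adj G)

  side-ab side-bc side-cd side-da : Fin k → Fin n → Fin n → Bool
  side-ab i = isEdge (a (sq i)) (b (sq i))
  side-bc i = isEdge (b (sq i)) (c (sq i))
  side-cd i = isEdge (c (sq i)) (d (sq i))
  side-da i = isEdge (d (sq i)) (a (sq i))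

  kept⇒square : ∀ {i u v} → Kept i u v → sqEdge (sq i) u v ≡ true
  kept⇒square {i} {u} {v} (kept h) with ∨-elim (side-bc i u v) _ h
  ... | inj₁ bc = ∨-introʳ (side-ab i u v) _ (∨-introˡ (side-bc i u v) _ bc)
  ... | inj₂ da = ∨-introʳ (side-ab i u v) _ (∨-introʳ (side-bc i u v) _ (∨-introʳ (side-cd i u v) _ da))

  kept-sym : ∀ {i u v} → Kept i u v → Kept i v u
  kept-sym {i} {u} {v} (kept h) with ∨-elim (side-bc i u v) _ h
  ... | inj₁ bc = kept (∨-introˡ (side-bc i v u) _ (isEdge-sym _ _ u v bc))
  ... | inj₂ da = kept (∨-introʳ (side-bc i v u) _ (isEdge-sym _ _ u v da))

  kept-unique : ∀ {i j u v} → Kept i u v → Kept j u v → i ≡ j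
  kept-unique {i} {j} {u} {v} kᵢ kⱼ =
    proj₂ (proj₂ (proj₂ (proj₂ union))) i j u v (kept⇒square kᵢ) (kept⇒square kⱼ)

  square⇒G : ∀ {i u v} → sqEdge (sq i) u v ≡ true → Adj G u v
  square⇒G {i} {u} {v} = proj₁ (proj₂ (proj₂ union)) i u v

  F-elim : ∀ {u v} → F u v → Adj E u v ⊎ ∃ λ i → Kept i u v
  F-elim {u} {v} uv with ∨-elim (adj E u v) _ uv
  ... | inj₁ e = inj₁ e
  ... | inj₂ h = let (i , hᵢ) = any-witness _ (allFin k) h in inj₂ (i , kept hᵢ)

  E⇒F : ∀ {u v} → Adj E u v → F u v
  E⇒F e = ∨-introˡ _ _ e

  kept⇒F : ∀ {i u v} → Kept i u v → F u v
  kept⇒F {i} {u} {v} (kept h) = ∨-introʳ (adj E u v) _ (any-allFin (λ j → halfEdge (sq j) u v) i h)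

  F⊆G : ∀ {u v} → F u v → Adj G u v
  F⊆G uv with F-elim uv
  ... | inj₁ e      = proj₁ (proj₂ union) _ _ e
  ... | inj₂ (_ , k) = square⇒G (kept⇒square k)

  F-sym : ∀ {u v} → F u v → F v u
  F-sym {u} {v} uv with F-elim uv
  ... | inj₁ e      = E⇒F (trans (Graph.sym E v u) e)
  ... | inj₂ (_ , k) = kept⇒F (kept-sym k)

  -- F has no loops: E has none and the corners of a square are distinct.
  F-irrefl : ∀ u → ¬ F u u
  F-irrefl u uu with F-elim uu
  ... | inj₁ e = case-false (trans (sym e) (irrefl E u))
    where case-false : ¬ true ≡ false
          case-false ()
  ... | inj₂ (i , kept h) with ∨-elim (side-bc i u u) _ h
  ...   | inj₁ bc = b≢c (sq i) (isEdge-loop u bc)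
  ...   | inj₂ da = a≢d (sq i) (sym (isEdge-loop u da))

  open TwoRegular F F-sym F-irrefl (twoFactor-neighbours (halvedAdj sq E) two-factor)

  AllCorners : Fin k → (Fin n → Set) → Set
  AllCorners i P = P (a (sq i)) × P (b (sq i)) × P (c (sq i)) × P (d (sq i))

  AllCorners-map : ∀ {i} {P Q : Fin n → Set} → (∀ {z} → P z → Q z) → AllCorners i P → AllCorners i Q
  AllCorners-map f (pa , pb , pc , pd) = f pa , f pb , f pc , f pd

  kept-end : ∀ {i u v} (P : Fin n → Set) → Kept i u v → AllCorners i P → P v
  kept-end {i} {u} {v} P (kept h) (pa , pb , pc , pd) with ∨-elim (side-bc i u v) _ h
  ... | inj₁ bc with isEdge-elim _ _ u v bc
  ...   | inj₁ (_ , refl) = pc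
  ...   | inj₂ (_ , refl) = pb
  kept-end {i} {u} {v} P (kept h) (pa , pb , pc , pd) | inj₂ da with isEdge-elim _ _ u v da
  ...   | inj₁ (_ , refl) = pa
  ...   | inj₂ (_ , refl) = pd

  Covered : CycleG → Fin n → Fin n → Set
  Covered L u v = (Edge L u v ⊎ Edge L v u) ⊎ ∃ λ i → Kept i u v × AllCorners i (_∈C L)

  Saturated : CycleG → Set
  Saturated L = ∀ {u v} → u ∈C L → F u v → Covered L u v

  saturated-closed : ∀ L → Saturated L → ∀ {u v} → u ∈C L → F u v → v ∈C L
  saturated-closed L sat u∈ uv with sat u∈ uv
  ... | inj₁ (inj₁ (t , _ , ev)) = suc t , ev
  ... | inj₁ (inj₂ (t , ev , _)) = t , ev
  ... | inj₂ (i , k , corners) = kept-end (_∈C L) k corners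

  F-cycle : ∀ {y y′} → F y′ y → CycleG
  F-cycle {y} {y′} y′y = mapCycle F⊆G (ClosedWalk.cycle y′ y y′y)

  F-cycle-saturated : ∀ {y y′} (y′y : F y′ y) → Saturated (F-cycle y′y)
  F-cycle-saturated {y} {y′} y′y u∈ uv = inj₁ (ClosedWalk.cycle-closed y′ y y′y u∈ uv)

  -- A square with a kept edge x→x′ on L whose other kept edge y′y leaves
  -- L; the deleted edges xy and y′x′ link the two kept edges.
  record Crossing (L : CycleG) : Set₁ where
    field
      square     : Fin k
      x x′ y y′  : Fin n
      on-L       : Edge L x x′
      kept-on-L  : Kept square x x′
      kept-off-L : Kept square y′ y
      link       : Adj G x y
      link′      : Adj G y′ x′
      y′∉L       : ¬ y′ ∈C L
      corners    : ∀ (P : Fin n → Set) → P x → P x′ → P y → P y′ → AllCorners square P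

  module Growth (L : CycleG) (sat : Saturated L) (cr : Crossing L) where
    open Crossing cr
    module W = ClosedWalk y′ y (kept⇒F kept-off-L)

    W : CycleG
    W = F-cycle (kept⇒F kept-off-L)

    -- W is F-connected to y′ ∉ L, and L is closed under F.
    W-avoids-L : ∀ t → ¬ W.walk t ∈C L
    W-avoids-L zero      = y′∉L
    W-avoids-L (suc t) m = W-avoids-L t (saturated-closed L sat m (F-sym (W.walk-linked t)))

    spliced : Splice L W x x′ y y′
    spliced = splice L W (λ t t′ eq → W-avoids-L t′ (t , eq)) on-L (0 , refl , refl) link link′

    -- Any splice of L and W along the crossing is saturated: an edge of L or
    -- W survives unless it is a removed kept edge, and those are covered by
    -- the square, whose corners all lie on the splice.
    splice-saturated : (S : Splice L W x x′ y y′) → Saturated (Splice.cycle S)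
    splice-saturated S = saturated′
      where
      open Splice S
      inside : AllCorners square (_∈C cycle)
      inside = let (j , ex , ex′) = on-L in
        corners (_∈C cycle) (∈L (j , ex)) (∈L (suc j , ex′)) (∈W (1 , refl)) (∈W (0 , refl))
      forward : ∀ {u v p q} → Kept square p q → Edge cycle u v ⊎ (u ≡ p × v ≡ q) → Covered cycle u v
      forward _ (inj₁ e)             = inj₁ (inj₁ e)
      forward k (inj₂ (refl , refl)) = inj₂ (square , k , inside)
      backward : ∀ {u v p q} → Kept square p q → Edge cycle v u ⊎ (v ≡ p × u ≡ q) → Covered cycle u v
      backward _ (inj₁ e)             = inj₁ (inj₂ e)
      backward k (inj₂ (refl , refl)) = inj₂ (square , kept-sym k , inside)
      saturated′ : Saturated cycle
      saturated′ u∈ uv with ∈⁻ u∈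
      ... | inj₁ u∈L with sat u∈L uv
      ...   | inj₁ (inj₁ e)        = forward kept-on-L (EdgeL e)
      ...   | inj₁ (inj₂ e)        = backward kept-on-L (EdgeL e)
      ...   | inj₂ (i , k , on-L′) = inj₂ (i , k , AllCorners-map {P = _∈C L} {Q = _∈C cycle} ∈L on-L′)
      saturated′ u∈ uv | inj₂ u∈W = on-W (W.cycle-closed u∈W uv)
        where
        on-W : ∀ {u v} → Edge W u v ⊎ Edge W v u → Covered cycle u v
        on-W (inj₁ e) = forward kept-off-L (EdgeW e)
        on-W (inj₂ e) = backward kept-off-L (EdgeW e)

  grow : ∀ L → Saturated L → Crossing L → Σ CycleG λ L′ → Saturated L′ × suc (last L) ≤ last L′
  grow L sat cr = cycle , splice-saturated spliced , longer
    where open Growth L sat cr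
          open Splice spliced

  module Corners (i : Fin k) where
    A B C D : Fin n
    A = a (sq i)
    B = b (sq i)
    C = c (sq i)
    D = d (sq i)

    AD : Kept i A D
    AD = kept (∨-introʳ (side-bc i A D) _ (isEdge-bwd D A))
    DA : Kept i D A
    DA = kept (∨-introʳ (side-bc i D A) _ (isEdge-fwd D A))
    BC : Kept i B C
    BC = kept (∨-introˡ (side-bc i B C) _ (isEdge-fwd B C))
    CB : Kept i C B
    CB = kept (∨-introˡ (side-bc i C B) _ (isEdge-bwd B C))

    A—B : Adj G A B
    A—B = square⇒G (∨-introˡ (side-ab i A B) _ (isEdge-fwd A B))
    B—A : Adj G B A
    B—A = square⇒G (∨-introˡ (side-ab i B A) _ (isEdge-bwd A B))
    C—D : Adj G C D
    C—D = square⇒G (∨-introʳ (side-ab i C D) _ (∨-introʳ (side-bc i C D) _ (∨-introˡ (side-cd i C D) _ (isEdge-fwd C D))))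
    D—C : Adj G D C
    D—C = square⇒G (∨-introʳ (side-ab i D C) _ (∨-introʳ (side-bc i D C) _ (∨-introˡ (side-cd i D C) _ (isEdge-bwd C D))))

    square-edge-cases : ∀ {u v} → sqEdge (sq i) u v ≡ true →
                        Kept i u v ⊎ ((u ≡ A × v ≡ B) ⊎ (u ≡ B × v ≡ A)) ⊎ ((u ≡ C × v ≡ D) ⊎ (u ≡ D × v ≡ C))
    square-edge-cases {u} {v} e with ∨-elim (side-ab i u v) _ e
    ... | inj₁ ab = inj₂ (inj₁ (isEdge-elim _ _ u v ab))
    ... | inj₂ e′ with ∨-elim (side-bc i u v) _ e′
    ...   | inj₁ bc = inj₁ (kept (∨-introˡ (side-bc i u v) _ bc))
    ...   | inj₂ e″ with ∨-elim (side-cd i u v) _ e″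
    ...     | inj₁ cd = inj₂ (inj₂ (isEdge-elim _ _ u v cd))
    ...     | inj₂ da = inj₁ (kept (∨-introʳ (side-bc i u v) _ da))

  module _ (L : CycleG) (sat : Saturated L) (i : Fin k) where
    open Corners i

    -- Corner A on L, B off L: the kept edge at A lies on L in one of its
    -- two directions, and either direction yields a crossing.
    crossing-from-A : A ∈C L → ¬ B ∈C L → Crossing L
    crossing-from-A A∈ B∉ with sat A∈ (kept⇒F AD)
    ... | inj₂ (i′ , k , inside) rewrite kept-unique k AD = ⊥-elim (B∉ (proj₁ (proj₂ inside)))
    ... | inj₁ (inj₁ A→D) = record
      { square = i ; on-L = A→D ; kept-on-L = AD ; kept-off-L = CB ; link = A—B ; link′ = C—D
      ; y′∉L = λ C∈ → B∉ (saturated-closed L sat C∈ (kept⇒F CB))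
      ; corners = λ P pA pD pB pC → pA , pB , pC , pD }
    ... | inj₁ (inj₂ D→A) = record
      { square = i ; on-L = D→A ; kept-on-L = DA ; kept-off-L = BC ; link = D—C ; link′ = B—A
      ; y′∉L = B∉ ; corners = λ P pD pA pC pB → pA , pB , pC , pD }

    crossing-from-B : B ∈C L → ¬ A ∈C L → Crossing L
    crossing-from-B B∈ A∉ with sat B∈ (kept⇒F BC)
    ... | inj₂ (i′ , k , inside) rewrite kept-unique k BC = ⊥-elim (A∉ (proj₁ inside))
    ... | inj₁ (inj₁ B→C) = record
      { square = i ; on-L = B→C ; kept-on-L = BC ; kept-off-L = DA ; link = B—A ; link′ = D—C
      ; y′∉L = λ D∈ → A∉ (saturated-closed L sat D∈ (kept⇒F DA))
      ; corners = λ P pB pC pA pD → pA , pB , pC , pD }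
    ... | inj₁ (inj₂ C→B) = record
      { square = i ; on-L = C→B ; kept-on-L = CB ; kept-off-L = AD ; link = C—D ; link′ = A—B
      ; y′∉L = A∉ ; corners = λ P pC pB pD pA → pA , pB , pC , pD }

  -- An edge of G leaving a saturated cycle is a deleted edge of some square
  -- (E-edges and kept edges stay inside), and so gives a crossing.
  crossing : ∀ L → Saturated L → ∀ {u v} → u ∈C L → ¬ v ∈C L → Adj G u v → Crossing L
  crossing L sat {u} {v} u∈ v∉ uv with proj₁ union u v uv
  ... | inj₁ e       = ⊥-elim (v∉ (saturated-closed L sat u∈ (E⇒F e)))
  ... | inj₂ (i , e) with Corners.square-edge-cases i e
  ...   | inj₁ k                           = ⊥-elim (v∉ (saturated-closed L sat u∈ (kept⇒F k)))
  ...   | inj₂ (inj₁ (inj₁ (refl , refl))) = crossing-from-A L sat i u∈ v∉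
  ...   | inj₂ (inj₁ (inj₂ (refl , refl))) = crossing-from-B L sat i u∈ v∉
  ...   | inj₂ (inj₂ (inj₁ (refl , refl))) =
          crossing-from-B L sat i (saturated-closed L sat u∈ (kept⇒F (Corners.CB i)))
                                  (λ A∈ → v∉ (saturated-closed L sat A∈ (kept⇒F (Corners.AD i))))
  ...   | inj₂ (inj₂ (inj₂ (refl , refl))) =
          crossing-from-A L sat i (saturated-closed L sat u∈ (kept⇒F (Corners.DA i)))
                                  (λ B∈ → v∉ (saturated-closed L sat B∈ (kept⇒F (Corners.BC i))))

  module _ (walks : ∀ u v → Walk G u v) where

    -- A saturated cycle missing a vertex can be grown: a walk from it to a
    -- missing vertex leaves it along some edge of G.
    grow-step : ∀ L → Saturated L → ¬ n ≤ suc (last L) →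
                Σ CycleG λ L′ → Saturated L′ × suc (last L) ≤ last L′
    grow-step L sat short with missing-vertex L short
    ... | w , w∉ with leaving-edge G (λ x → x ∈C? L) (walks (at L 0) w) (0 , refl) w∉
    ...   | u , v , u∈ , v∉ , uv = grow L sat (crossing L sat u∈ v∉ uv)

    -- Growing repeatedly reaches a cycle through all n vertices; each step
    -- adds a vertex, so fuel = n ∸ length suffices.
    spanning-cycle : ∀ fuel L → Saturated L → n ≤ suc (last L) + fuel → Σ CycleG λ L′ → suc (last L′) ≡ n
    spanning-cycle fuel L sat bound with n ≤? suc (last L)
    ... | yes enough = L , ≤-antisym (length≤n L) enough
    spanning-cycle zero L sat bound | no short = ⊥-elim (short (subst (n ≤_) (+-identityʳ _) bound))
    spanning-cycle (suc fuel) L sat bound | no short = continue (grow-step L sat short)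
      where
      continue : (Σ CycleG λ L′ → Saturated L′ × suc (last L) ≤ last L′) → Σ CycleG λ L′ → suc (last L′) ≡ n
      continue (L′ , sat′ , longer) = spanning-cycle fuel L′ sat′ (≤-trans bound budget)
        where
        budget : suc (last L) + suc fuel ≤ suc (last L′) + fuel
        budget = subst (_≤ suc (last L′) + fuel) (sym (+-suc (suc (last L)) fuel)) (+-monoˡ-≤ fuel (s≤s longer))

  -- Connected ⇒ Hamiltonian: start from the F-cycle through any vertex v and
  -- grow it; v and its two F-neighbours show n ≥ 3.
  connected⇒hamiltonian : Connected G → Hamiltonian G
  connected⇒hamiltonian (1≤n , walks) =
    spanning-cycle⇒hamiltonian G (proj₁ spanning) (proj₂ spanning)
      (three-distinct⇒3≤n (v≢ P-fst) (v≢ P-snd) fst≢snd)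
    where
    v : Fin n
    v = fromℕ< 1≤n
    open ExactlyTwo (twoFactor-neighbours (halvedAdj sq E) two-factor v)
    v≢ : ∀ {w} → F v w → ¬ v ≡ w
    v≢ vw refl = F-irrefl v vw
    spanning : Σ CycleG λ L → suc (last L) ≡ n
    spanning = spanning-cycle walks n (F-cycle P-fst) (F-cycle-saturated P-fst) (m≤n+m n _)

lemma2 : {n k : ℕ} (G : Graph n) (sq : Fin k → Square n) (E : Graph n) →
         EdgeDisjointUnion G sq E →
         TwoFactor (halvedAdj sq E) →
         Hamiltonian G ⇔ Connected G
lemma2 G sq E union two-factor =
  mk⇔ (hamiltonian⇒connected G) (Halving.connected⇒hamiltonian G sq E union two-factor)
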